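{- Let $E=(e_X,e_Y,R)$ be a 3-coherent extension polarity extending the poset $P$. For $x\in X$ and $y\in Y$ consider: a) there is $S\subseteq P$ with $\bigwedge e_X[S]\le_X x$ and $y\le_Y e_Y(p)$ for all $p\in S$; b) there is $T\subseteq P$ with $\bigvee e_Y[T]\ge_Y y$ and $e_X(q)\le_X x$ for all $q\in T$; c) for all $p,q\in P$, if $e_Y(p)\le_Y y$ and $x\le_X e_X(q)$ then $p\le_P q$. Then for all $x\in X$, $y\in Y$, each of a) and b) implies c). Moreover, if $E$ is a Galois polarity, then a), b) and c) are equivalent for all $x\in X$, $y\in Y$.
   Context: For a poset $Q$, $q^\uparrow=\{r:r\ge q\}$, $q^\downarrow=\{r:r\le q\}$. An order embedding $e:P\to Q$ is a meet-extension if $q=\bigwedge e[e^{ -1}(q^\uparrow)]$ for all $q\in Q$, and a join-extension if $q=\bigvee e[e^{ -1}(q^\downarrow)]$ for all $q\in Q$. An extension polarity is a triple $(e_X,e_Y,R)$ where $P$ is a poset, $X,Y$ disjoint posets, $e_X:P\to X$, $e_Y:P\to Y$ order embeddings, $R\subseteq X\times Y$. It is 3-coherent if: (C1) $x_1\le_X x_2$ and $x_2\mathrel{R}y$ imply $x_1\mathrel{R}y$; (C2) $y_1\le_Y y_2$ and $x\mathrel{R}y_1$ imply $x\mathrel{R}y_2$; (C3) $e_X(p)\mathrel{R}e_Y(p)$ for all $p\in P$; (C4) $x\mathrel{R}e_Y(p)$ and $e_X(p)\mathrel{R}y$ imply $x\mathrel{R}y$; (C5) $x_1\mathrel{R}e_Y(p)$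 and $e_X(p)\le_X x_2$ imply $x_1\le_X x_2$; (C6) $y_1\le_Y e_Y(p)$ and $e_X(p)\mathrel{R}y_2$ imply $y_1\le_Y y_2$; (C7) if $S\subseteq P$, $\bigwedge e_X[S]=x$ in $X$, $x\mathrel{R}y_2$ and $y_1\le_Y e_Y(p)$ for all $p\in S$, then $y_1\le_Y y_2$; (C8) if $T\subseteq P$, $\bigvee e_Y[T]=y$ in $Y$, $x_1\mathrel{R}y$ and $e_X(q)\le_X x_2$ for all $q\in T$, then $x_1\le_X x_2$. A Galois polarity is a 3-coherent extension polarity with $e_X$ a meet-extension and $e_Y$ a join-extension. In a) and b), the meet $\bigwedge e_X[S]$ (resp. join $\bigvee e_Y[T]$) is required to exist in $X$ (resp. $Y$). -}

module Defs where

open import Level using (0ℓ)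
open import Data.Product using (Σ; _×_; _,_)
open import Relation.Binary.Bundles using (Poset)
open import Relation.Unary using (Pred)
open import Function.Bundles using (_⇔_)

Subset : Set → Set₁
Subset A = Pred A 0ℓ

module _ {P Q : Poset 0ℓ 0ℓ 0ℓ} where
  private
    module P = Poset P
    module Q = Poset Q

  IsOrderEmbedding : (P.Carrier → Q.Carrier) → Set
  IsOrderEmbedding e = ∀ p q → (p P.≤ q) ⇔ (e p Q.≤ e q)

  IsMeetOfImage : (P.Carrier → Q.Carrier) → Subset P.Carrier → Q.Carrier → Set
  IsMeetOfImage e S m =
    (∀ p → S p → m Q.≤ e p) ×
    (∀ z → (∀ p → S p → z Q.≤ e p) → z Q.≤ m)

  IsJoinOfImage : (P.Carrier → Q.Carrier) → Subset P.Carrier → Q.Carrier → Set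
  IsJoinOfImage e T m =
    (∀ p → T p → e p Q.≤ m) ×
    (∀ z → (∀ p → T p → e p Q.≤ z) → m Q.≤ z)

  IsMeetExtension : (P.Carrier → Q.Carrier) → Set
  IsMeetExtension e = ∀ q → IsMeetOfImage e (λ p → q Q.≤ e p) q

  IsJoinExtension : (P.Carrier → Q.Carrier) → Set
  IsJoinExtension e = ∀ q → IsJoinOfImage e (λ p → e p Q.≤ q) q

record ExtensionPolarity (P : Poset 0ℓ 0ℓ 0ℓ) : Set₁ where
  field
    X Y   : Poset 0ℓ 0ℓ 0ℓ
    eX    : Poset.Carrier P → Poset.Carrier X
    eY    : Poset.Carrier P → Poset.Carrier Y
    eX-emb : IsOrderEmbedding {P} {X} eX
    eY-emb : IsOrderEmbedding {P} {Y} eY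
    R     : Poset.Carrier X → Poset.Carrier Y → Set

module _ {P : Poset 0ℓ 0ℓ 0ℓ} (E : ExtensionPolarity P) where
  open ExtensionPolarity E
  private
    module P = Poset P
    module X = Poset X
    module Y = Poset Y

  record IsThreeCoherent : Set₁ where
    field
      C1 : ∀ {x₁ x₂ y} → x₁ X.≤ x₂ → R x₂ y → R x₁ y
      C2 : ∀ {x y₁ y₂} → y₁ Y.≤ y₂ → R x y₁ → R x y₂
      C3 : ∀ p → R (eX p) (eY p)
      C4 : ∀ {x y p} → R x (eY p) → R (eX p) y → R x y
      C5 : ∀ {x₁ x₂ p} → R x₁ (eY p) → eX p X.≤ x₂ → x₁ X.≤ x₂
      C6 : ∀ {y₁ y₂ p} → y₁ Y.≤ eY p → R (eX p) y₂ → y₁ Y.≤ y₂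
      C7 : ∀ (S : Subset P.Carrier) {x y₁ y₂} →
           IsMeetOfImage {P} {X} eX S x → R x y₂ →
           (∀ p → S p → y₁ Y.≤ eY p) → y₁ Y.≤ y₂
      C8 : ∀ (T : Subset P.Carrier) {y x₁ x₂} →
           IsJoinOfImage {P} {Y} eY T y → R x₁ y →
           (∀ q → T q → eX q X.≤ x₂) → x₁ X.≤ x₂

  record IsGaloisPolarity : Set₁ where
    field
      coherent : IsThreeCoherent
      eX-meet  : IsMeetExtension {P} {X} eX
      eY-join  : IsJoinExtension {P} {Y} eY

  CondA : X.Carrier → Y.Carrier → Set₁
  CondA x y = Σ (Subset P.Carrier) λ S → Σ X.Carrier λ m →
    IsMeetOfImage {P} {X} eX S m × m X.≤ x × (∀ p → S p → y Y.≤ eY p)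

  CondB : X.Carrier → Y.Carrier → Set₁
  CondB x y = Σ (Subset P.Carrier) λ T → Σ Y.Carrier λ j →
    IsJoinOfImage {P} {Y} eY T j × y Y.≤ j × (∀ q → T q → eX q X.≤ x)

  CondC : X.Carrier → Y.Carrier → Set
  CondC x y = ∀ p q → eY p Y.≤ y → x X.≤ eX q → p P.≤ q

module Submission where

open import Defs
open import Level using (0ℓ)
open import Data.Product using (_×_; _,_; proj₂)
open import Relation.Binary.Bundles using (Poset)
open import Function.Bundles using (_⇔_; mk⇔; Equivalence)

-- a) ⇒ c) and b) ⇒ c) apply the order embedding to C7, resp. C8, with the
-- single element eY p ≤ y, resp. eX q ≥ x, as the test element.  Conversely,
-- in a Galois polarity c) holds with the canonical witnesses S = {p ∣ x ≤ eX p}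
-- (whose meet is x) and T = {p ∣ eY p ≤ y} (whose join is y).

module _ {P : Poset 0ℓ 0ℓ 0ℓ} (E : ExtensionPolarity P) where
  open ExtensionPolarity E
  private
    module X = Poset X
    module Y = Poset Y

  condA⇒condC : IsThreeCoherent E → ∀ x y → CondA E x y → CondC E x y
  condA⇒condC coh x y (S , m , m-meet , m≤x , y≤eY[S]) p q eYp≤y x≤eXq =
    Equivalence.from (eY-emb p q)
      (C7 S m-meet (C1 (X.trans m≤x x≤eXq) (C3 q))
          (λ s s∈S → Y.trans eYp≤y (y≤eY[S] s s∈S)))
    where open IsThreeCoherent coh

  condB⇒condC : IsThreeCoherent E → ∀ x y → CondB E x y → CondC E x y
  condB⇒condC coh x y (T , j , j-join , y≤j , eX[T]≤x) p q eYp≤y x≤eXq =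
    Equivalence.from (eX-emb p q)
      (C8 T j-join (C2 (Y.trans eYp≤y y≤j) (C3 p))
          (λ t t∈T → X.trans (eX[T]≤x t t∈T) x≤eXq))
    where open IsThreeCoherent coh

  condC⇒condA : IsMeetExtension {P} {X} eX → IsJoinExtension {P} {Y} eY →
                ∀ x y → CondC E x y → CondA E x y
  condC⇒condA eX-meet eY-join x y c =
    (λ p → x X.≤ eX p) , x , eX-meet x , X.refl ,
    λ p x≤eXp → proj₂ (eY-join y) (eY p)
      (λ r eYr≤y → Equivalence.to (eY-emb r p) (c r p eYr≤y x≤eXp))

  condC⇒condB : IsMeetExtension {P} {X} eX → IsJoinExtension {P} {Y} eY →
                ∀ x y → CondC E x y → CondB E x y
  condC⇒condB eX-meet eY-join x y c =
    (λ p → eY p Y.≤ y) , y , eY-join y , Y.refl ,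
    λ q eYq≤y → proj₂ (eX-meet x) (eX q)
      (λ r x≤eXr → Equivalence.to (eX-emb q r) (c q r eYq≤y x≤eXr))

lemma4p9 : (P : Poset 0ℓ 0ℓ 0ℓ) (E : ExtensionPolarity P) →
    (IsThreeCoherent E →
      ∀ x y → (CondA E x y → CondC E x y) × (CondB E x y → CondC E x y)) ×
    (IsGaloisPolarity E →
      ∀ x y → (CondA E x y ⇔ CondB E x y) × (CondB E x y ⇔ CondC E x y))
lemma4p9 P E =
  (λ coh x y → condA⇒condC E coh x y , condB⇒condC E coh x y) ,
  λ galois x y →
    let open IsGaloisPolarity galois
        a⇒c = condA⇒condC E coherent x y
        b⇒c = condB⇒condC E coherent x y
        c⇒a = condC⇒condA E eX-meet eY-join x y
        c⇒b = condC⇒condB E eX-meet eY-join x y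
    in mk⇔ (λ a → c⇒b (a⇒c a)) (λ b → c⇒a (b⇒c b)) , mk⇔ b⇒c c⇒b
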